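{- In the setting described in the context, for every $0\le i\le D$ we have $PB_i=B_i^*P$ and $PB_i^*=B_iP$.
   Context: Let $D$ be a positive integer. Define $c_i=\frac{3(D-i+1)i(D+i+1)}{D(D+2)(2i+1)}$ ($1\le i\le D$), $a_i=\frac{3i(i+1)}{D(D+2)}$ ($0\le i\le D$), $b_i=\frac{3(D-i)(i+1)(D+i+2)}{D(D+2)(2i+1)}$ ($0\le i\le D-1$), $\theta_i=3-2a_i$ ($0\le i\le D$). Matrices are $(D+1)\times(D+1)$ real with rows and columns indexed by $0,\dots,D$. $A$ is the tridiagonal matrix with diagonal entries $A_{i,i}=a_i$, superdiagonal $A_{i,i+1}=b_i$, subdiagonal $A_{i,i-1}=c_i$, all other entries $0$; $A^*=\mathrm{diag}(\theta_0,\dots,\theta_D)$. Polynomials $u_0,\dots,u_D\in\mathbb R[\lambda]$: $u_0=1$, $u_1=\lambda/3$, $\lambda u_i=b_iu_{i+1}+a_iu_i+c_iu_{i-1}$ ($1\le i\le D-1$); $k_i=\frac{b_0\cdots b_{i-1}}{c_1\cdots c_i}$; $v_i=k_iu_i$. Set $B_i=v_i(A)$ and $B_i^*=v_i(A^*)$. $P$ is the matrix with $P_{i,j}=(2j+1)\,{}_4F_3\!\left[\begin{matrix} -i,\ i+1,\ -j,\ j+1\\ 1,\ D+2,\ -D\end{matrix};1\right]$, where ${}_4F_3\!\left[\begin{matrix} a_1,a_2,a_3,a_4\\ b_1,b_2,b_3\end{matrix};z\right]=\sum_{n\ge0}\frac{(a_1)_n(a_2)_n(a_3)_n(a_4)_n}{(b_1)_n(b_2)_n(b_3)_n}\frac{z^n}{n!}$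 and $(a)_n=a(a+1)\cdots(a+n-1)$. -}

module Defs where

open import Data.Nat as ℕ using (ℕ; zero; suc)
open import Data.Fin as Fin using (Fin; toℕ)
open import Data.Integer using (+_)
open import Data.Rational using (ℚ; 0ℚ; 1ℚ; _+_; _*_; _-_; -_; _/_; _÷_; _≟_; ≢-nonZero)
open import Data.List using (List; []; _∷_)
open import Data.Product using (_×_; _,_; proj₁)
open import Relation.Nullary using (yes; no)
open import Relation.Binary.PropositionalEquality using (_≡_)

⟦_⟧ : ℕ → ℚ
⟦ n ⟧ = + n / 1

-- total division: q ÷' 0 := 0 (only ever applied to nonzero divisors below)
_÷'_ : ℚ → ℚ → ℚ
p ÷' q with q ≟ 0ℚ
... | yes _ = 0ℚ
... | no q≢0 = _÷_ p q {{≢-nonZero q≢0}}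

den : ℕ → ℚ
den D = ⟦ D ⟧ * ⟦ D ℕ.+ 2 ⟧

cc : ℕ → ℕ → ℚ
cc D i = (⟦ 3 ⟧ * ⟦ D ℕ.∸ i ℕ.+ 1 ⟧ * ⟦ i ⟧ * ⟦ D ℕ.+ i ℕ.+ 1 ⟧)
         ÷' (den D * ⟦ 2 ℕ.* i ℕ.+ 1 ⟧)

aa : ℕ → ℕ → ℚ
aa D i = (⟦ 3 ⟧ * ⟦ i ⟧ * ⟦ i ℕ.+ 1 ⟧) ÷' den D

bb : ℕ → ℕ → ℚ
bb D i = (⟦ 3 ⟧ * ⟦ D ℕ.∸ i ⟧ * ⟦ i ℕ.+ 1 ⟧ * ⟦ D ℕ.+ i ℕ.+ 2 ⟧)
         ÷' (den D * ⟦ 2 ℕ.* i ℕ.+ 1 ⟧)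

θ : ℕ → ℕ → ℚ
θ D i = ⟦ 3 ⟧ - ⟦ 2 ⟧ * aa D i

Mat : ℕ → Set
Mat D = Fin (suc D) → Fin (suc D) → ℚ

∑ : ∀ {n} → (Fin n → ℚ) → ℚ
∑ {zero} f = 0ℚ
∑ {suc n} f = f Fin.zero + ∑ (λ k → f (Fin.suc k))

infixl 7 _⊗_
_⊗_ : ∀ {D} → Mat D → Mat D → Mat D
(M ⊗ N) r s = ∑ (λ k → M r k * N k s)

_⊕_ : ∀ {D} → Mat D → Mat D → Mat D
(M ⊕ N) r s = M r s + N r s

_·_ : ∀ {D} → ℚ → Mat D → Mat D
(c · M) r s = c * M r s

δ : ℕ → ℕ → ℚ
δ m n with m ℕ.≟ n
... | yes _ = 1ℚ
... | no _ = 0ℚ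

idM : ∀ {D} → Mat D
idM r s = δ (toℕ r) (toℕ s)

zeroM : ∀ {D} → Mat D
zeroM r s = 0ℚ

_≋_ : ∀ {D} → Mat D → Mat D → Set
M ≋ N = ∀ r s → M r s ≡ N r s

entryA : ℕ → ℕ → ℕ → ℚ
entryA D i j =
  aa D i * δ i j + bb D i * δ (suc i) j + cc D i * δ i (suc j)

A : (D : ℕ) → Mat D
A D r s = entryA D (toℕ r) (toℕ s)

A* : (D : ℕ) → Mat D
A* D r s = θ D (toℕ r) * δ (toℕ r) (toℕ s)

-- Polynomials in λ over ℚ: coefficient lists, lowest degree first

Poly : Set
Poly = List ℚ

infixl 6 _+ₚ_
infixr 7 _·ₚ_
_+ₚ_ : Poly → Poly → Poly
[] +ₚ q = q
(a ∷ p) +ₚ [] = a ∷ p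
(a ∷ p) +ₚ (b ∷ q) = (a + b) ∷ (p +ₚ q)

_·ₚ_ : ℚ → Poly → Poly
c ·ₚ [] = []
c ·ₚ (a ∷ p) = (c * a) ∷ (c ·ₚ p)

Xₚ : Poly → Poly
Xₚ p = 0ℚ ∷ p

-- pairs (u_i , u_{i+1}); recursion
--   u_0 = 1, u_1 = λ/3,
--   u_{i+1} = (λ u_i - a_i u_i - c_i u_{i-1}) / b_i
uPair : ℕ → ℕ → Poly × Poly
uPair D zero = (1ℚ ∷ []) , (0ℚ ∷ (1ℚ ÷' ⟦ 3 ⟧) ∷ [])
uPair D (suc i) with uPair D i
... | (p , q) =
  q , ((1ℚ ÷' bb D (suc i)) ·ₚ
        (Xₚ q +ₚ ((- aa D (suc i)) ·ₚ q) +ₚ ((- cc D (suc i)) ·ₚ p)))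

u : ℕ → ℕ → Poly
u D i = proj₁ (uPair D i)

prodB : ℕ → ℕ → ℚ
prodB D zero = 1ℚ
prodB D (suc i) = prodB D i * bb D i

prodC : ℕ → ℕ → ℚ
prodC D zero = 1ℚ
prodC D (suc i) = prodC D i * cc D (suc i)

k : ℕ → ℕ → ℚ
k D i = prodB D i ÷' prodC D i

v : ℕ → ℕ → Poly
v D i = k D i ·ₚ u D i

evalM : ∀ {D} → Poly → Mat D → Mat D
evalM [] M = zeroM
evalM (c ∷ p) M = (c · idM) ⊕ (M ⊗ evalM p M)

B : (D : ℕ) → Fin (suc D) → Mat D
B D i = evalM (v D (toℕ i)) (A D)

B* : (D : ℕ) → Fin (suc D) → Mat D
B* D i = evalM (v D (toℕ i)) (A* D)

poch : ℚ → ℕ → ℚ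
poch x zero = 1ℚ
poch x (suc n) = poch x n * (x + ⟦ n ⟧)

fact : ℕ → ℚ
fact zero = 1ℚ
fact (suc n) = fact n * ⟦ suc n ⟧

term : ℕ → ℕ → ℕ → ℕ → ℚ
term D i j n =
  (poch (- ⟦ i ⟧) n * poch ⟦ i ℕ.+ 1 ⟧ n * poch (- ⟦ j ⟧) n * poch ⟦ j ℕ.+ 1 ⟧ n)
  ÷' (poch 1ℚ n * poch ⟦ D ℕ.+ 2 ⟧ n * poch (- ⟦ D ⟧) n * fact n)

sumTo : (ℕ → ℚ) → ℕ → ℚ
sumTo f zero = f zero
sumTo f (suc m) = sumTo f m + f (suc m)

-- the series terminates: terms with n > i vanish since (-i)_n = 0, and
-- (-D)_n ≠ 0 for n ≤ D, so summing n = 0 … D gives the 4F3 exactly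
F43 : ℕ → ℕ → ℕ → ℚ
F43 D i j = sumTo (term D i j) D

P : (D : ℕ) → Mat D
P D r s = ⟦ 2 ℕ.* toℕ s ℕ.+ 1 ⟧ * F43 D (toℕ r) (toℕ s)

{-# OPTIONS --safe #-}
module Submission where

-- With T(x, n) = (-x)_n (x+1)_n and h_n = (1)_n (D+2)_n (-D)_n n!, we have P_{rs} = (2s+1) F(r, s) where
-- F(r, s) = Σ_{n ≤ D} T(r, n) T(s, n) / h_n is symmetric in r and s.  In r, F satisfies the three-term recurrence
-- θ_s F(r, s) = c_r F(r-1, s) + a_r F(r, s) + b_r F(r+1, s): termwise, a contiguous relation of T(x, n) in x and
-- the relation (θ_s - θ_n) T(s, n) ∝ T(s, n+1) agree up to remainders that telescope in n, because T(s, D+1) = 0.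
-- With the symmetry of F and (2k+1) A_{ks} = A_{sk} (2s+1) (i.e. (2k+1) b_k = (2k+3) c_{k+1}) this is PA = A*P
-- and PA* = AP, and a matrix intertwining A with A* intertwines v_i(A) with v_i(A*).

open import Defs
open import Data.Nat as ℕ using (ℕ; zero; suc; _≤_; _<_; z≤n; s≤s)
import Data.Nat.Properties as ℕP
import Data.Nat.Coprimality as Coprime
import Data.Integer as ℤ
import Data.Integer.Properties as ℤP
open import Data.Rational using (ℚ; mkℚ; 0ℚ; 1ℚ; _+_; _*_; _-_; -_; _/_; _≟_; ≢-nonZero; ↥_)
import Data.Rational.Properties as ℚP
open import Data.Fin as Fin using (Fin; toℕ; fromℕ<)
import Data.Fin.Properties as FinP
open import Data.List using ([]; _∷_)
open import Data.Product using (_×_; _,_)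
open import Data.Sum using (inj₁; inj₂)
open import Level using (0ℓ)
open import Relation.Nullary.Decidable using (yes; no; dec⇒maybe)
open import Relation.Nullary.Negation using (contradiction)
open import Relation.Binary.PropositionalEquality
open import Tactic.RingSolver using (solve-∀)
import Tactic.RingSolver.Core.AlmostCommutativeRing as ACR

open ≡-Reasoning

ℚ-ring : ACR.AlmostCommutativeRing 0ℓ 0ℓ
ℚ-ring = ACR.fromCommutativeRing ℚP.+-*-commutativeRing (λ x → dec⇒maybe (0ℚ ≟ x))

cong₃ : ∀ {A B C E : Set} (f : A → B → C → E) {a a′ b b′ c c′} →
        a ≡ a′ → b ≡ b′ → c ≡ c′ → f a b c ≡ f a′ b′ c′
cong₃ f refl refl refl = refl

⟦⟧≡mkℚ : ∀ n → ⟦ n ⟧ ≡ mkℚ (ℤ.+ n) 0 (Coprime.sym (Coprime.1-coprimeTo n))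
⟦⟧≡mkℚ n = ℚP.normalize-coprime (Coprime.sym (Coprime.1-coprimeTo n))

⟦⟧-suc : ∀ n → ⟦ suc n ⟧ ≡ ⟦ n ⟧ + 1ℚ
⟦⟧-suc n rewrite ⟦⟧≡mkℚ n = cong (_/ 1) (sym numerator)
  where
  numerator : ℤ.+ n ℤ.* ℤ.+ 1 ℤ.+ ℤ.+ 1 ℤ.* ℤ.+ 1 ≡ ℤ.+ suc n
  numerator = trans (cong (ℤ._+ ℤ.+ 1) (ℤP.*-identityʳ (ℤ.+ n))) (ℤP.+-comm (ℤ.+ n) (ℤ.+ 1))

⟦⟧-+ : ∀ m n → ⟦ m ℕ.+ n ⟧ ≡ ⟦ m ⟧ + ⟦ n ⟧
⟦⟧-+ zero n = sym (ℚP.+-identityˡ ⟦ n ⟧)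
⟦⟧-+ (suc m) n = begin
  ⟦ suc (m ℕ.+ n) ⟧  ≡⟨ ⟦⟧-suc (m ℕ.+ n) ⟩
  ⟦ m ℕ.+ n ⟧ + 1ℚ   ≡⟨ cong (_+ 1ℚ) (⟦⟧-+ m n) ⟩
  ⟦ m ⟧ + ⟦ n ⟧ + 1ℚ ≡⟨ swap ⟦ m ⟧ ⟦ n ⟧ ⟩
  ⟦ m ⟧ + 1ℚ + ⟦ n ⟧ ≡⟨ cong (_+ ⟦ n ⟧) (sym (⟦⟧-suc m)) ⟩
  ⟦ suc m ⟧ + ⟦ n ⟧  ∎
  where
  swap : ∀ a b → a + b + 1ℚ ≡ a + 1ℚ + b
  swap = solve-∀ ℚ-ring

⟦⟧-∸ : ∀ {m n} → n ≤ m → ⟦ m ℕ.∸ n ⟧ ≡ ⟦ m ⟧ - ⟦ n ⟧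
⟦⟧-∸ {m} {n} n≤m = begin
  ⟦ m ℕ.∸ n ⟧                 ≡⟨ add-sub ⟦ m ℕ.∸ n ⟧ ⟦ n ⟧ ⟩
  ⟦ m ℕ.∸ n ⟧ + ⟦ n ⟧ - ⟦ n ⟧ ≡⟨ cong (_- ⟦ n ⟧) (sym (⟦⟧-+ (m ℕ.∸ n) n)) ⟩
  ⟦ m ℕ.∸ n ℕ.+ n ⟧ - ⟦ n ⟧   ≡⟨ cong (λ z → ⟦ z ⟧ - ⟦ n ⟧) (ℕP.m∸n+n≡m n≤m) ⟩
  ⟦ m ⟧ - ⟦ n ⟧               ∎
  where
  add-sub : ∀ a b → a ≡ a + b - b
  add-sub = solve-∀ ℚ-ring

⟦⟧-injective : ∀ {m n} → ⟦ m ⟧ ≡ ⟦ n ⟧ → m ≡ n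
⟦⟧-injective {m} {n} eq = ℤP.+-injective (cong ↥_ (trans (sym (⟦⟧≡mkℚ m)) (trans eq (⟦⟧≡mkℚ n))))

⟦suc⟧≢0 : ∀ n → ⟦ suc n ⟧ ≢ 0ℚ
⟦suc⟧≢0 n eq with ⟦⟧-injective {suc n} {0} eq
... | ()

inv : ℚ → ℚ
inv q = 1ℚ ÷' q

÷'≡*inv : ∀ p q → p ÷' q ≡ p * inv q
÷'≡*inv p q with q ≟ 0ℚ
... | yes _ = sym (ℚP.*-zeroʳ p)
... | no _  = cong (p *_) (sym (ℚP.*-identityˡ _))

*-inv : ∀ {q} → q ≢ 0ℚ → q * inv q ≡ 1ℚ
*-inv {q} q≢0 with q ≟ 0ℚ
... | yes q≡0 = contradiction q≡0 q≢0
... | no q≢0′ = trans (cong (q *_) (ℚP.*-identityˡ _)) (ℚP.*-inverseʳ q {{≢-nonZero q≢0′}})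

*-cancelʳ : ∀ {x y} z → z ≢ 0ℚ → x * z ≡ y * z → x ≡ y
*-cancelʳ {x} {y} z z≢0 eq = begin
  x                ≡⟨ sym (ℚP.*-identityʳ x) ⟩
  x * 1ℚ           ≡⟨ cong (x *_) (sym (*-inv z≢0)) ⟩
  x * (z * inv z)  ≡⟨ sym (ℚP.*-assoc x z (inv z)) ⟩
  x * z * inv z    ≡⟨ cong (_* inv z) eq ⟩
  y * z * inv z    ≡⟨ ℚP.*-assoc y z (inv z) ⟩
  y * (z * inv z)  ≡⟨ cong (y *_) (*-inv z≢0) ⟩
  y * 1ℚ           ≡⟨ ℚP.*-identityʳ y ⟩
  y                ∎

*-≢0 : ∀ {x y} → x ≢ 0ℚ → y ≢ 0ℚ → x * y ≢ 0ℚ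
*-≢0 {x} {y} x≢0 y≢0 xy≡0 = x≢0 (*-cancelʳ y y≢0 (trans xy≡0 (sym (ℚP.*-zeroˡ y))))

÷'-*-cancel : ∀ p {q} → q ≢ 0ℚ → (p ÷' q) * q ≡ p
÷'-*-cancel p {q} q≢0 = begin
  (p ÷' q) * q    ≡⟨ cong (_* q) (÷'≡*inv p q) ⟩
  p * inv q * q   ≡⟨ ℚP.*-assoc p (inv q) q ⟩
  p * (inv q * q) ≡⟨ cong (p *_) (trans (ℚP.*-comm (inv q) q) (*-inv q≢0)) ⟩
  p * 1ℚ          ≡⟨ ℚP.*-identityʳ p ⟩
  p               ∎

inv-* : ∀ {x y} → x ≢ 0ℚ → y ≢ 0ℚ → inv (x * y) ≡ inv x * inv y
inv-* {x} {y} x≢0 y≢0 = *-cancelʳ (x * y) (*-≢0 x≢0 y≢0) (begin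
  inv (x * y) * (x * y)      ≡⟨ ℚP.*-comm (inv (x * y)) (x * y) ⟩
  x * y * inv (x * y)        ≡⟨ *-inv (*-≢0 x≢0 y≢0) ⟩
  1ℚ                         ≡⟨ cong₂ _*_ (*-inv x≢0) (*-inv y≢0) ⟨
  x * inv x * (y * inv y)    ≡⟨ regroup x y (inv x) (inv y) ⟩
  inv x * inv y * (x * y)    ∎)
  where
  regroup : ∀ a b a′ b′ → a * a′ * (b * b′) ≡ a′ * b′ * (a * b)
  regroup = solve-∀ ℚ-ring

sumTo-cong : ∀ {f g} k → (∀ n → n ≤ k → f n ≡ g n) → sumTo f k ≡ sumTo g k
sumTo-cong zero    f≗g = f≗g zero z≤n
sumTo-cong (suc k) f≗g =
  cong₂ _+_ (sumTo-cong k (λ n n≤k → f≗g n (ℕP.m≤n⇒m≤1+n n≤k))) (f≗g (suc k) ℕP.≤-refl)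

sumTo-+ : ∀ f g k → sumTo (λ n → f n + g n) k ≡ sumTo f k + sumTo g k
sumTo-+ f g zero    = refl
sumTo-+ f g (suc k) = trans (cong (_+ (f (suc k) + g (suc k))) (sumTo-+ f g k))
                            (interchange (sumTo f k) (sumTo g k) (f (suc k)) (g (suc k)))
  where
  interchange : ∀ a b c d → a + b + (c + d) ≡ a + c + (b + d)
  interchange = solve-∀ ℚ-ring

sumTo-*ˡ : ∀ c f k → sumTo (λ n → c * f n) k ≡ c * sumTo f k
sumTo-*ˡ c f zero    = refl
sumTo-*ˡ c f (suc k) = trans (cong (_+ c * f (suc k)) (sumTo-*ˡ c f k))
                             (sym (ℚP.*-distribˡ-+ c (sumTo f k) (f (suc k))))

sumTo-sucˡ : ∀ f k → sumTo f (suc k) ≡ f 0 + sumTo (λ n → f (suc n)) k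
sumTo-sucˡ f zero    = refl
sumTo-sucˡ f (suc k) = trans (cong (_+ f (suc (suc k))) (sumTo-sucˡ f k)) (ℚP.+-assoc (f 0) _ _)

sumTo-+-*ˡ : ∀ f c g k → sumTo (λ n → f n + c * g n) k ≡ sumTo f k + c * sumTo g k
sumTo-+-*ˡ f c g k = trans (sumTo-+ f (λ n → c * g n) k) (cong (sumTo f k +_) (sumTo-*ˡ c g k))

sumTo-linear₃ : ∀ a b c f g h k →
  sumTo (λ n → a * f n + b * g n + c * h n) k ≡ a * sumTo f k + b * sumTo g k + c * sumTo h k
sumTo-linear₃ a b c f g h k = begin
  sumTo (λ n → a * f n + b * g n + c * h n) k
    ≡⟨ sumTo-+ (λ n → a * f n + b * g n) (λ n → c * h n) k ⟩
  sumTo (λ n → a * f n + b * g n) k + sumTo (λ n → c * h n) k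
    ≡⟨ cong (_+ sumTo (λ n → c * h n) k) (sumTo-+ (λ n → a * f n) (λ n → b * g n) k) ⟩
  sumTo (λ n → a * f n) k + sumTo (λ n → b * g n) k + sumTo (λ n → c * h n) k
    ≡⟨ cong₃ (λ p q r → p + q + r) (sumTo-*ˡ a f k) (sumTo-*ˡ b g k) (sumTo-*ˡ c h k) ⟩
  a * sumTo f k + b * sumTo g k + c * sumTo h k ∎

sumTo-telescope : ∀ (h g : ℕ → ℚ) k → h 0 ≡ 0ℚ → g k ≡ 0ℚ →
                  (∀ m → m < k → h (suc m) ≡ g m) → sumTo h k ≡ sumTo g k
sumTo-telescope h g zero    h0 gk _      = trans h0 (sym gk)
sumTo-telescope h g (suc k) h0 gk h∘suc≗g = begin
  sumTo h (suc k)                    ≡⟨ sumTo-sucˡ h k ⟩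
  h 0 + sumTo (λ n → h (suc n)) k    ≡⟨ cong₂ _+_ h0 (sumTo-cong k (λ n n≤k → h∘suc≗g n (s≤s n≤k))) ⟩
  0ℚ + sumTo g k                     ≡⟨ ℚP.+-identityˡ _ ⟩
  sumTo g k                          ≡⟨ ℚP.+-identityʳ _ ⟨
  sumTo g k + 0ℚ                     ≡⟨ cong (sumTo g k +_) gk ⟨
  sumTo g (suc k)                    ∎

∑-cong : ∀ {n} {f g : Fin n → ℚ} → (∀ k → f k ≡ g k) → ∑ f ≡ ∑ g
∑-cong {zero}  f≗g = refl
∑-cong {suc n} f≗g = cong₂ _+_ (f≗g Fin.zero) (∑-cong (λ k → f≗g (Fin.suc k)))

∑-+ : ∀ {n} (f g : Fin n → ℚ) → ∑ (λ k → f k + g k) ≡ ∑ f + ∑ g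
∑-+ {zero}  f g = refl
∑-+ {suc n} f g = trans (cong (f Fin.zero + g Fin.zero +_) (∑-+ (λ k → f (Fin.suc k)) (λ k → g (Fin.suc k))))
                        (interchange (f Fin.zero) (g Fin.zero) _ _)
  where
  interchange : ∀ a b c d → a + b + (c + d) ≡ a + c + (b + d)
  interchange = solve-∀ ℚ-ring

∑-*ˡ : ∀ {n} c (f : Fin n → ℚ) → ∑ (λ k → c * f k) ≡ c * ∑ f
∑-*ˡ {zero}  c f = sym (ℚP.*-zeroʳ c)
∑-*ˡ {suc n} c f = trans (cong (c * f Fin.zero +_) (∑-*ˡ c (λ k → f (Fin.suc k))))
                         (sym (ℚP.*-distribˡ-+ c _ _))

∑-zero : ∀ {n} (f : Fin n → ℚ) → (∀ k → f k ≡ 0ℚ) → ∑ f ≡ 0ℚ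
∑-zero {zero}  f f≗0 = refl
∑-zero {suc n} f f≗0 = cong₂ _+_ (f≗0 Fin.zero) (∑-zero (λ k → f (Fin.suc k)) (λ k → f≗0 (Fin.suc k)))

∑-swap : ∀ {m n} (f : Fin m → Fin n → ℚ) → ∑ (λ i → ∑ (λ j → f i j)) ≡ ∑ (λ j → ∑ (λ i → f i j))
∑-swap {zero}  {n} f = sym (∑-zero {n} (λ _ → 0ℚ) (λ _ → refl))
∑-swap {suc m} {n} f = trans (cong (∑ (f Fin.zero) +_) (∑-swap (λ i → f (Fin.suc i))))
                             (sym (∑-+ (f Fin.zero) (λ j → ∑ (λ i → f (Fin.suc i) j))))

∑-*ʳ : ∀ {n} c (f : Fin n → ℚ) → ∑ (λ k → f k * c) ≡ ∑ f * c
∑-*ʳ c f = trans (∑-cong (λ k → ℚP.*-comm (f k) c)) (trans (∑-*ˡ c f) (ℚP.*-comm c (∑ f)))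

∑-linear₃ : ∀ {n} a b c (f g h : Fin n → ℚ) →
  ∑ (λ k → a * f k + b * g k + c * h k) ≡ a * ∑ f + b * ∑ g + c * ∑ h
∑-linear₃ a b c f g h = begin
  ∑ (λ k → a * f k + b * g k + c * h k)
    ≡⟨ ∑-+ (λ k → a * f k + b * g k) (λ k → c * h k) ⟩
  ∑ (λ k → a * f k + b * g k) + ∑ (λ k → c * h k)
    ≡⟨ cong (_+ ∑ (λ k → c * h k)) (∑-+ (λ k → a * f k) (λ k → b * g k)) ⟩
  ∑ (λ k → a * f k) + ∑ (λ k → b * g k) + ∑ (λ k → c * h k)
    ≡⟨ cong₃ (λ p q r → p + q + r) (∑-*ˡ a f) (∑-*ˡ b g) (∑-*ˡ c h) ⟩
  a * ∑ f + b * ∑ g + c * ∑ h ∎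

δ-refl : ∀ n → δ n n ≡ 1ℚ
δ-refl n with n ℕ.≟ n
... | yes _   = refl
... | no n≢n = contradiction refl n≢n

δ-≢ : ∀ {m n} → m ≢ n → δ m n ≡ 0ℚ
δ-≢ {m} {n} m≢n with m ℕ.≟ n
... | yes m≡n = contradiction m≡n m≢n
... | no _    = refl

δ-suc : ∀ m n → δ (suc m) (suc n) ≡ δ m n
δ-suc m n with m ℕ.≟ n
... | yes refl = δ-refl (suc m)
... | no m≢n   = δ-≢ (λ eq → m≢n (ℕP.suc-injective eq))

δ-sym : ∀ m n → δ m n ≡ δ n m
δ-sym m n with m ℕ.≟ n
... | yes refl = sym (δ-refl m)
... | no m≢n   = sym (δ-≢ (λ eq → m≢n (sym eq)))

*δ-cong : ∀ {x y} m n → (m ≡ n → x ≡ y) → x * δ m n ≡ y * δ m n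
*δ-cong {x} {y} m n x≡y with m ℕ.≟ n
... | yes m≡n = cong (_* 1ℚ) (x≡y m≡n)
... | no _    = trans (ℚP.*-zeroʳ x) (sym (ℚP.*-zeroʳ y))

∑-δ : ∀ {n} (f : Fin n → ℚ) t → ∑ (λ k → δ (toℕ t) (toℕ k) * f k) ≡ f t
∑-δ {suc n} f Fin.zero = begin
  δ 0 0 * f Fin.zero + ∑ (λ k → δ 0 (suc (toℕ k)) * f (Fin.suc k))
    ≡⟨ cong₂ _+_ (cong (_* f Fin.zero) (δ-refl 0))
                 (∑-zero _ (λ k → ℚP.*-zeroˡ (f (Fin.suc k)))) ⟩
  1ℚ * f Fin.zero + 0ℚ ≡⟨ trans (ℚP.+-identityʳ _) (ℚP.*-identityˡ _) ⟩
  f Fin.zero           ∎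
∑-δ {suc n} f (Fin.suc t) = begin
  δ (suc (toℕ t)) 0 * f Fin.zero + ∑ (λ k → δ (suc (toℕ t)) (suc (toℕ k)) * f (Fin.suc k))
    ≡⟨ cong₂ _+_ (ℚP.*-zeroˡ (f Fin.zero))
                 (trans (∑-cong (λ k → cong (_* f (Fin.suc k)) (δ-suc (toℕ t) (toℕ k))))
                        (∑-δ (λ k → f (Fin.suc k)) t)) ⟩
  0ℚ + f (Fin.suc t)   ≡⟨ ℚP.+-identityˡ _ ⟩
  f (Fin.suc t)        ∎

∑-δ-< : ∀ {n} (f : ℕ → ℚ) {t} → t < n → ∑ {n} (λ k → δ t (toℕ k) * f (toℕ k)) ≡ f t
∑-δ-< {n} f {t} t<n = begin
  ∑ {n} (λ k → δ t (toℕ k) * f (toℕ k))         ≡⟨ ∑-cong {n} (λ k → cong (λ u → δ u (toℕ k) * f (toℕ k)) (sym toℕ-t′)) ⟩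
  ∑ {n} (λ k → δ (toℕ t′) (toℕ k) * f (toℕ k))  ≡⟨ ∑-δ (λ k → f (toℕ k)) t′ ⟩
  f (toℕ t′)                                    ≡⟨ cong f toℕ-t′ ⟩
  f t                                           ∎
  where
  t′ : Fin n
  t′ = fromℕ< t<n
  toℕ-t′ : toℕ t′ ≡ t
  toℕ-t′ = FinP.toℕ-fromℕ< t<n

∑-δ-≥ : ∀ {n} (f : ℕ → ℚ) {t} → n ≤ t → ∑ {n} (λ k → δ t (toℕ k) * f (toℕ k)) ≡ 0ℚ
∑-δ-≥ {n} f n≤t = ∑-zero {n} _ (λ k →
  trans (cong (_* f (toℕ k)) (δ-≢ {n = toℕ k} (λ t≡k → ℕP.<⇒≱ (FinP.toℕ<n k) (subst (_ ≤_) t≡k n≤t))))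
        (ℚP.*-zeroˡ (f (toℕ k))))

module _ {D : ℕ} where

  ⊗-congˡ : ∀ (X : Mat D) {Y Y′} → Y ≋ Y′ → (X ⊗ Y) ≋ (X ⊗ Y′)
  ⊗-congˡ X Y≋Y′ r s = ∑-cong (λ k → cong (X r k *_) (Y≋Y′ k s))

  ⊗-congʳ : ∀ {X X′} (Y : Mat D) → X ≋ X′ → (X ⊗ Y) ≋ (X′ ⊗ Y)
  ⊗-congʳ Y X≋X′ r s = ∑-cong (λ k → cong (_* Y k s) (X≋X′ r k))

  ⊗-assoc : (X Y Z : Mat D) → ((X ⊗ Y) ⊗ Z) ≋ (X ⊗ (Y ⊗ Z))
  ⊗-assoc X Y Z r s = begin
    ∑ (λ k → ∑ (λ j → X r j * Y j k) * Z k s)  ≡⟨ ∑-cong (λ k → sym (∑-*ʳ (Z k s) (λ j → X r j * Y j k))) ⟩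
    ∑ (λ k → ∑ (λ j → X r j * Y j k * Z k s))  ≡⟨ ∑-swap (λ k j → X r j * Y j k * Z k s) ⟩
    ∑ (λ j → ∑ (λ k → X r j * Y j k * Z k s))  ≡⟨ ∑-cong (λ j → trans (∑-cong (λ k → ℚP.*-assoc (X r j) (Y j k) (Z k s)))
                                                                    (∑-*ˡ (X r j) (λ k → Y j k * Z k s))) ⟩
    ∑ (λ j → X r j * ∑ (λ k → Y j k * Z k s))  ∎

  ⊗-distribˡ-⊕ : (X Y Z : Mat D) → (X ⊗ (Y ⊕ Z)) ≋ ((X ⊗ Y) ⊕ (X ⊗ Z))
  ⊗-distribˡ-⊕ X Y Z r s =
    trans (∑-cong (λ k → ℚP.*-distribˡ-+ (X r k) (Y k s) (Z k s))) (∑-+ (λ k → X r k * Y k s) (λ k → X r k * Z k s))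

  ⊗-distribʳ-⊕ : (X Y Z : Mat D) → ((Y ⊕ Z) ⊗ X) ≋ ((Y ⊗ X) ⊕ (Z ⊗ X))
  ⊗-distribʳ-⊕ X Y Z r s =
    trans (∑-cong (λ k → ℚP.*-distribʳ-+ (X k s) (Y r k) (Z r k))) (∑-+ (λ k → Y r k * X k s) (λ k → Z r k * X k s))

  ⊗-scalarʳ : (X : Mat D) (c : ℚ) → (X ⊗ (c · idM)) ≋ (c · X)
  ⊗-scalarʳ X c r s = begin
    ∑ (λ k → X r k * (c * δ (toℕ k) (toℕ s)))  ≡⟨ ∑-cong (λ k → trans (cong (λ d → X r k * (c * d)) (δ-sym (toℕ k) (toℕ s)))
                                                                    (reorder (X r k) c (δ (toℕ s) (toℕ k)))) ⟩
    ∑ (λ k → c * (δ (toℕ s) (toℕ k) * X r k))  ≡⟨ ∑-*ˡ c (λ k → δ (toℕ s) (toℕ k) * X r k) ⟩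
    c * ∑ (λ k → δ (toℕ s) (toℕ k) * X r k)    ≡⟨ cong (c *_) (∑-δ (X r) s) ⟩
    c * X r s                                  ∎
    where
    reorder : ∀ x c d → x * (c * d) ≡ c * (d * x)
    reorder = solve-∀ ℚ-ring

  ⊗-scalarˡ : (X : Mat D) (c : ℚ) → ((c · idM) ⊗ X) ≋ (c · X)
  ⊗-scalarˡ X c r s = begin
    ∑ (λ k → c * δ (toℕ r) (toℕ k) * X k s)    ≡⟨ ∑-cong (λ k → ℚP.*-assoc c (δ (toℕ r) (toℕ k)) (X k s)) ⟩
    ∑ (λ k → c * (δ (toℕ r) (toℕ k) * X k s))  ≡⟨ ∑-*ˡ c (λ k → δ (toℕ r) (toℕ k) * X k s) ⟩
    c * ∑ (λ k → δ (toℕ r) (toℕ k) * X k s)    ≡⟨ cong (c *_) (∑-δ (λ k → X k s) r) ⟩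
    c * X r s                                  ∎

  ⊗-zeroʳ : (X : Mat D) → (X ⊗ zeroM) ≋ zeroM
  ⊗-zeroʳ X r s = ∑-zero (λ k → X r k * 0ℚ) (λ k → ℚP.*-zeroʳ (X r k))

  ⊗-zeroˡ : (X : Mat D) → (zeroM ⊗ X) ≋ zeroM
  ⊗-zeroˡ X r s = ∑-zero (λ k → 0ℚ * X k s) (λ k → ℚP.*-zeroˡ (X k s))

  evalM-intertwine : ∀ (X M N : Mat D) → (X ⊗ M) ≋ (N ⊗ X) →
                     ∀ p → (X ⊗ evalM p M) ≋ (evalM p N ⊗ X)
  evalM-intertwine X M N XM≋NX [] r s = trans (⊗-zeroʳ X r s) (sym (⊗-zeroˡ X r s))
  evalM-intertwine X M N XM≋NX (c ∷ p) r s = begin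
    (X ⊗ ((c · idM) ⊕ (M ⊗ E))) r s           ≡⟨ ⊗-distribˡ-⊕ X (c · idM) (M ⊗ E) r s ⟩
    ((X ⊗ (c · idM)) ⊕ (X ⊗ (M ⊗ E))) r s     ≡⟨ cong₂ _+_ (⊗-scalarʳ X c r s) (sym (⊗-assoc X M E r s)) ⟩
    ((c · X) ⊕ ((X ⊗ M) ⊗ E)) r s             ≡⟨ cong (c * X r s +_) (⊗-congʳ E XM≋NX r s) ⟩
    ((c · X) ⊕ ((N ⊗ X) ⊗ E)) r s             ≡⟨ cong (c * X r s +_) (⊗-assoc N X E r s) ⟩
    ((c · X) ⊕ (N ⊗ (X ⊗ E))) r s             ≡⟨ cong (c * X r s +_) (⊗-congˡ N (evalM-intertwine X M N XM≋NX p) r s) ⟩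
    ((c · X) ⊕ (N ⊗ (E′ ⊗ X))) r s            ≡⟨ cong₂ _+_ (sym (⊗-scalarˡ X c r s)) (sym (⊗-assoc N E′ X r s)) ⟩
    (((c · idM) ⊗ X) ⊕ ((N ⊗ E′) ⊗ X)) r s    ≡⟨ ⊗-distribʳ-⊕ X (c · idM) (N ⊗ E′) r s ⟨
    (((c · idM) ⊕ (N ⊗ E′)) ⊗ X) r s          ∎
    where
    E E′ : Mat D
    E  = evalM p M
    E′ = evalM p N

-- The contiguous relation

pairPoch : ℚ → ℕ → ℚ
pairPoch x n = poch (- x) n * poch (x + 1ℚ) n

odd : ℚ → ℚ
odd x = ⟦ 2 ⟧ * x + 1ℚ

-- With d = D and x = i: cPoly d x, aPoly x * odd x and bPoly d x are D(D+2)(2i+1) times c_i, a_i and b_i,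
-- and θPoly d x is D(D+2) θ_i.
cPoly : ℚ → ℚ → ℚ
cPoly d x = ⟦ 3 ⟧ * (d - x + 1ℚ) * x * (d + x + 1ℚ)

aPoly : ℚ → ℚ
aPoly x = ⟦ 3 ⟧ * x * (x + 1ℚ)

bPoly : ℚ → ℚ → ℚ
bPoly d x = ⟦ 3 ⟧ * (d - x) * (x + 1ℚ) * (d + x + ⟦ 2 ⟧)

θPoly : ℚ → ℚ → ℚ
θPoly d x = ⟦ 3 ⟧ * (d * (d + ⟦ 2 ⟧)) - ⟦ 6 ⟧ * x * (x + 1ℚ)

βPoly : ℚ → ℚ → ℚ
βPoly d ν = ⟦ 6 ⟧ * ν * ν * (d + 1ℚ + ν) * (ν - 1ℚ - d)

poch-sucˡ : ∀ a m → poch a (suc m) ≡ a * poch (a + 1ℚ) m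
poch-sucˡ a zero    = identity a
  where
  identity : ∀ a → 1ℚ * (a + ⟦ 0 ⟧) ≡ a * 1ℚ
  identity = solve-∀ ℚ-ring
poch-sucˡ a (suc m) = begin
  poch a (suc m) * (a + ⟦ suc m ⟧)            ≡⟨ cong₂ (λ p μ → p * (a + μ)) (poch-sucˡ a m) (⟦⟧-suc m) ⟩
  a * poch (a + 1ℚ) m * (a + (⟦ m ⟧ + 1ℚ))    ≡⟨ identity a (poch (a + 1ℚ) m) ⟦ m ⟧ ⟩
  a * (poch (a + 1ℚ) m * (a + 1ℚ + ⟦ m ⟧))    ∎
  where
  identity : ∀ a p μ → a * p * (a + (μ + 1ℚ)) ≡ a * (p * (a + 1ℚ + μ))
  identity = solve-∀ ℚ-ring

pairPoch-one : ∀ y → pairPoch y 1 ≡ - y * (y + 1ℚ)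
pairPoch-one y = identity y
  where
  identity : ∀ y → 1ℚ * (- y + ⟦ 0 ⟧) * (1ℚ * (y + 1ℚ + ⟦ 0 ⟧)) ≡ - y * (y + 1ℚ)
  identity = solve-∀ ℚ-ring

module _ (x : ℚ) (m : ℕ) where
  private
    U V μ : ℚ
    U = poch (- x + 1ℚ) m
    V = poch (x + 1ℚ + 1ℚ) m
    μ = ⟦ m ⟧

  pairPoch-pred-2+ : pairPoch (x - 1ℚ) (2 ℕ.+ m)
                     ≡ U * (- x + 1ℚ + μ) * (- x + 1ℚ + (μ + 1ℚ)) * (x * ((x + 1ℚ) * V))
  pairPoch-pred-2+ = cong₂ _*_
    (cong₃ (λ a μ′ b → poch a m * (a + μ) * (b + μ′)) (neg-pred x) (⟦⟧-suc m) (neg-pred x))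
    (begin
      poch (x - 1ℚ + 1ℚ) (2 ℕ.+ m)
        ≡⟨ poch-sucˡ _ (suc m) ⟩
      (x - 1ℚ + 1ℚ) * poch (x - 1ℚ + 1ℚ + 1ℚ) (suc m)
        ≡⟨ cong ((x - 1ℚ + 1ℚ) *_) (poch-sucˡ _ m) ⟩
      (x - 1ℚ + 1ℚ) * ((x - 1ℚ + 1ℚ + 1ℚ) * poch (x - 1ℚ + 1ℚ + 1ℚ + 1ℚ) m)
        ≡⟨ cong₃ (λ a b c → a * (b * poch c m)) (shift₁ x) (shift₂ x) (shift₃ x) ⟩
      x * ((x + 1ℚ) * V) ∎)
    where
    neg-pred : ∀ x → - (x - 1ℚ) ≡ - x + 1ℚ
    neg-pred = solve-∀ ℚ-ring
    shift₁ : ∀ x → x - 1ℚ + 1ℚ ≡ x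
    shift₁ = solve-∀ ℚ-ring
    shift₂ : ∀ x → x - 1ℚ + 1ℚ + 1ℚ ≡ x + 1ℚ
    shift₂ = solve-∀ ℚ-ring
    shift₃ : ∀ x → x - 1ℚ + 1ℚ + 1ℚ + 1ℚ ≡ x + 1ℚ + 1ℚ
    shift₃ = solve-∀ ℚ-ring

  pairPoch-2+ : pairPoch x (2 ℕ.+ m) ≡ - x * (U * (- x + 1ℚ + μ)) * ((x + 1ℚ) * (V * (x + 1ℚ + 1ℚ + μ)))
  pairPoch-2+ = cong₂ _*_ (poch-sucˡ (- x) (suc m)) (poch-sucˡ (x + 1ℚ) (suc m))

  pairPoch-succ-2+ : pairPoch (x + 1ℚ) (2 ℕ.+ m)
                     ≡ - (x + 1ℚ) * ((- (x + 1ℚ) + 1ℚ) * U) * (V * (x + 1ℚ + 1ℚ + μ) * (x + 1ℚ + 1ℚ + (μ + 1ℚ)))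
  pairPoch-succ-2+ = cong₂ _*_
    (begin
      poch (- (x + 1ℚ)) (2 ℕ.+ m)
        ≡⟨ poch-sucˡ _ (suc m) ⟩
      - (x + 1ℚ) * poch (- (x + 1ℚ) + 1ℚ) (suc m)
        ≡⟨ cong (- (x + 1ℚ) *_) (poch-sucˡ _ m) ⟩
      - (x + 1ℚ) * ((- (x + 1ℚ) + 1ℚ) * poch (- (x + 1ℚ) + 1ℚ + 1ℚ) m)
        ≡⟨ cong (λ a → - (x + 1ℚ) * ((- (x + 1ℚ) + 1ℚ) * poch a m)) (shift x) ⟩
      - (x + 1ℚ) * ((- (x + 1ℚ) + 1ℚ) * U) ∎)
    (cong (λ μ′ → V * (x + 1ℚ + 1ℚ + μ) * (x + 1ℚ + 1ℚ + μ′)) (⟦⟧-suc m))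
    where
    shift : ∀ x → - (x + 1ℚ) + 1ℚ + 1ℚ ≡ - x + 1ℚ
    shift = solve-∀ ℚ-ring

  pairPoch-1+ : pairPoch x (suc m) ≡ - x * U * ((x + 1ℚ) * V)
  pairPoch-1+ = cong₂ _*_ (poch-sucˡ (- x) m) (poch-sucˡ (x + 1ℚ) m)

pairPoch-contiguous : ∀ d x n →
  cPoly d x * pairPoch (x - 1ℚ) n + aPoly x * odd x * pairPoch x n + bPoly d x * pairPoch (x + 1ℚ) n
  ≡ odd x * (θPoly d ⟦ n ⟧ * pairPoch x n + βPoly d ⟦ n ⟧ * pairPoch x (n ℕ.∸ 1))
pairPoch-contiguous d x 0 = identity d x
  where
  identity : ∀ d x →
    ⟦ 3 ⟧ * (d - x + 1ℚ) * x * (d + x + 1ℚ) * 1ℚ + ⟦ 3 ⟧ * x * (x + 1ℚ) * (⟦ 2 ⟧ * x + 1ℚ) * 1ℚ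
      + ⟦ 3 ⟧ * (d - x) * (x + 1ℚ) * (d + x + ⟦ 2 ⟧) * 1ℚ
    ≡ (⟦ 2 ⟧ * x + 1ℚ) * ((⟦ 3 ⟧ * (d * (d + ⟦ 2 ⟧)) - ⟦ 6 ⟧ * ⟦ 0 ⟧ * (⟦ 0 ⟧ + 1ℚ)) * 1ℚ
      + ⟦ 6 ⟧ * ⟦ 0 ⟧ * ⟦ 0 ⟧ * (d + 1ℚ + ⟦ 0 ⟧) * (⟦ 0 ⟧ - 1ℚ - d) * 1ℚ)
  identity = solve-∀ ℚ-ring
pairPoch-contiguous d x 1 = begin
  _ ≡⟨ cong₃ (λ p q r → cPoly d x * p + aPoly x * odd x * q + bPoly d x * r)
             (pairPoch-one (x - 1ℚ)) (pairPoch-one x) (pairPoch-one (x + 1ℚ)) ⟩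
  _ ≡⟨ identity d x ⟩
  _ ≡⟨ cong (λ p → odd x * (θPoly d ⟦ 1 ⟧ * p + βPoly d ⟦ 1 ⟧ * 1ℚ)) (sym (pairPoch-one x)) ⟩
  _ ∎
  where
  identity : ∀ d x →
    ⟦ 3 ⟧ * (d - x + 1ℚ) * x * (d + x + 1ℚ) * (- (x - 1ℚ) * (x - 1ℚ + 1ℚ))
      + ⟦ 3 ⟧ * x * (x + 1ℚ) * (⟦ 2 ⟧ * x + 1ℚ) * (- x * (x + 1ℚ))
      + ⟦ 3 ⟧ * (d - x) * (x + 1ℚ) * (d + x + ⟦ 2 ⟧) * (- (x + 1ℚ) * (x + 1ℚ + 1ℚ))
    ≡ (⟦ 2 ⟧ * x + 1ℚ) * ((⟦ 3 ⟧ * (d * (d + ⟦ 2 ⟧)) - ⟦ 6 ⟧ * ⟦ 1 ⟧ * (⟦ 1 ⟧ + 1ℚ)) * (- x * (x + 1ℚ))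
      + ⟦ 6 ⟧ * ⟦ 1 ⟧ * ⟦ 1 ⟧ * (d + 1ℚ + ⟦ 1 ⟧) * (⟦ 1 ⟧ - 1ℚ - d) * 1ℚ)
  identity = solve-∀ ℚ-ring
pairPoch-contiguous d x (suc (suc m)) = begin
  _ ≡⟨ cong₃ (λ p q r → cPoly d x * p + aPoly x * odd x * q + bPoly d x * r)
             (pairPoch-pred-2+ x m) (pairPoch-2+ x m) (pairPoch-succ-2+ x m) ⟩
  _ ≡⟨ identity d x ⟦ m ⟧ (poch (- x + 1ℚ) m) (poch (x + 1ℚ + 1ℚ) m) ⟩
  _ ≡⟨ cong₃ (λ ν p q → odd x * (θPoly d ν * p + βPoly d ν * q))
             (sym ⟦2+m⟧) (sym (pairPoch-2+ x m)) (sym (pairPoch-1+ x m)) ⟩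
  _ ∎
  where
  ⟦2+m⟧ : ⟦ 2 ℕ.+ m ⟧ ≡ ⟦ m ⟧ + 1ℚ + 1ℚ
  ⟦2+m⟧ = trans (⟦⟧-suc (suc m)) (cong (_+ 1ℚ) (⟦⟧-suc m))
  identity : ∀ d x μ U V →
    ⟦ 3 ⟧ * (d - x + 1ℚ) * x * (d + x + 1ℚ)
      * (U * (- x + 1ℚ + μ) * (- x + 1ℚ + (μ + 1ℚ)) * (x * ((x + 1ℚ) * V)))
    + ⟦ 3 ⟧ * x * (x + 1ℚ) * (⟦ 2 ⟧ * x + 1ℚ)
      * (- x * (U * (- x + 1ℚ + μ)) * ((x + 1ℚ) * (V * (x + 1ℚ + 1ℚ + μ))))
    + ⟦ 3 ⟧ * (d - x) * (x + 1ℚ) * (d + x + ⟦ 2 ⟧)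
      * (- (x + 1ℚ) * ((- (x + 1ℚ) + 1ℚ) * U) * (V * (x + 1ℚ + 1ℚ + μ) * (x + 1ℚ + 1ℚ + (μ + 1ℚ))))
    ≡ (⟦ 2 ⟧ * x + 1ℚ)
      * ((⟦ 3 ⟧ * (d * (d + ⟦ 2 ⟧)) - ⟦ 6 ⟧ * (μ + 1ℚ + 1ℚ) * (μ + 1ℚ + 1ℚ + 1ℚ))
          * (- x * (U * (- x + 1ℚ + μ)) * ((x + 1ℚ) * (V * (x + 1ℚ + 1ℚ + μ))))
        + ⟦ 6 ⟧ * (μ + 1ℚ + 1ℚ) * (μ + 1ℚ + 1ℚ) * (d + 1ℚ + (μ + 1ℚ + 1ℚ)) * (μ + 1ℚ + 1ℚ - 1ℚ - d)
          * (- x * U * ((x + 1ℚ) * V)))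
  identity = solve-∀ ℚ-ring

pairPoch-shift : ∀ d y n →
  θPoly d y * pairPoch y n ≡ θPoly d ⟦ n ⟧ * pairPoch y n + ⟦ 6 ⟧ * pairPoch y (suc n)
pairPoch-shift d y n = identity d y ⟦ n ⟧ (poch (- y) n) (poch (y + 1ℚ) n)
  where
  identity : ∀ d y ν p q →
    (⟦ 3 ⟧ * (d * (d + ⟦ 2 ⟧)) - ⟦ 6 ⟧ * y * (y + 1ℚ)) * (p * q)
    ≡ (⟦ 3 ⟧ * (d * (d + ⟦ 2 ⟧)) - ⟦ 6 ⟧ * ν * (ν + 1ℚ)) * (p * q) + ⟦ 6 ⟧ * (p * (- y + ν) * (q * (y + 1ℚ + ν)))
  identity = solve-∀ ℚ-ring

-- The terminating ₄F₃ and its recurrence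

hgDen : ℕ → ℕ → ℚ
hgDen D n = poch 1ℚ n * poch ⟦ D ℕ.+ 2 ⟧ n * poch (- ⟦ D ⟧) n * fact n

hgRatio : ℕ → ℕ → ℚ
hgRatio D m = (1ℚ + ⟦ m ⟧) * (⟦ D ℕ.+ 2 ⟧ + ⟦ m ⟧) * (- ⟦ D ⟧ + ⟦ m ⟧) * ⟦ suc m ⟧

hgDen-suc : ∀ D m → hgDen D (suc m) ≡ hgDen D m * hgRatio D m
hgDen-suc D m = identity (poch 1ℚ m) (poch ⟦ D ℕ.+ 2 ⟧ m) (poch (- ⟦ D ⟧) m) (fact m)
                         (1ℚ + ⟦ m ⟧) (⟦ D ℕ.+ 2 ⟧ + ⟦ m ⟧) (- ⟦ D ⟧ + ⟦ m ⟧) ⟦ suc m ⟧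
  where
  identity : ∀ a b c d x y z w → a * x * (b * y) * (c * z) * (d * w) ≡ a * b * c * d * (x * y * z * w)
  identity = solve-∀ ℚ-ring

hgRatio-≢0 : ∀ {D m} → m < D → hgRatio D m ≢ 0ℚ
hgRatio-≢0 {D} {m} m<D = *-≢0 (*-≢0 (*-≢0 1+m≢0 D+2+m≢0) m-D≢0) (⟦suc⟧≢0 m)
  where
  1+m≢0 : 1ℚ + ⟦ m ⟧ ≢ 0ℚ
  1+m≢0 eq = ⟦suc⟧≢0 m (trans (⟦⟧-+ 1 m) eq)
  D+2+m≢0 : ⟦ D ℕ.+ 2 ⟧ + ⟦ m ⟧ ≢ 0ℚ
  D+2+m≢0 eq = ⟦suc⟧≢0 (D ℕ.+ 1 ℕ.+ m)
    (trans (cong (λ n → ⟦ n ℕ.+ m ⟧) (sym (ℕP.+-suc D 1))) (trans (⟦⟧-+ (D ℕ.+ 2) m) eq))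
  m-D≢0 : - ⟦ D ⟧ + ⟦ m ⟧ ≢ 0ℚ
  m-D≢0 eq = ℕP.<⇒≢ m<D (⟦⟧-injective (begin
    ⟦ m ⟧                   ≡⟨ identity ⟦ D ⟧ ⟦ m ⟧ ⟩
    - ⟦ D ⟧ + ⟦ m ⟧ + ⟦ D ⟧ ≡⟨ cong (_+ ⟦ D ⟧) eq ⟩
    0ℚ + ⟦ D ⟧              ≡⟨ ℚP.+-identityˡ ⟦ D ⟧ ⟩
    ⟦ D ⟧                   ∎))
    where
    identity : ∀ d μ → μ ≡ - d + μ + d
    identity = solve-∀ ℚ-ring

hgDen-≢0 : ∀ {D m} → m ≤ D → hgDen D m ≢ 0ℚ
hgDen-≢0 {D} {zero}  _   = ⟦suc⟧≢0 0
hgDen-≢0 {D} {suc m} m<D eq =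
  *-≢0 (hgDen-≢0 (ℕP.<⇒≤ m<D)) (hgRatio-≢0 m<D) (trans (sym (hgDen-suc D m)) eq)

βPoly-suc : ∀ D m → βPoly ⟦ D ⟧ ⟦ suc m ⟧ ≡ ⟦ 6 ⟧ * hgRatio D m
βPoly-suc D m = begin
  βPoly ⟦ D ⟧ ⟦ suc m ⟧ ≡⟨ cong (βPoly ⟦ D ⟧) (⟦⟧-suc m) ⟩
  βPoly ⟦ D ⟧ (⟦ m ⟧ + 1ℚ)
    ≡⟨ identity ⟦ D ⟧ ⟦ m ⟧ ⟩
  ⟦ 6 ⟧ * ((1ℚ + ⟦ m ⟧) * (⟦ D ⟧ + ⟦ 2 ⟧ + ⟦ m ⟧) * (- ⟦ D ⟧ + ⟦ m ⟧) * (⟦ m ⟧ + 1ℚ))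
    ≡⟨ cong₂ (λ a b → ⟦ 6 ⟧ * ((1ℚ + ⟦ m ⟧) * (a + ⟦ m ⟧) * (- ⟦ D ⟧ + ⟦ m ⟧) * b)) (sym (⟦⟧-+ D 2)) (sym (⟦⟧-suc m)) ⟩
  ⟦ 6 ⟧ * hgRatio D m ∎
  where
  identity : ∀ d μ → ⟦ 6 ⟧ * (μ + 1ℚ) * (μ + 1ℚ) * (d + 1ℚ + (μ + 1ℚ)) * (μ + 1ℚ - 1ℚ - d)
                     ≡ ⟦ 6 ⟧ * ((1ℚ + μ) * (d + ⟦ 2 ⟧ + μ) * (- d + μ) * (μ + 1ℚ))
  identity = solve-∀ ℚ-ring

βPoly*inv-hgDen : ∀ {D m} → m < D → βPoly ⟦ D ⟧ ⟦ suc m ⟧ * inv (hgDen D (suc m)) ≡ ⟦ 6 ⟧ * inv (hgDen D m)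
βPoly*inv-hgDen {D} {m} m<D = begin
  βPoly ⟦ D ⟧ ⟦ suc m ⟧ * inv (hgDen D (suc m))   ≡⟨ cong₂ (λ a b → a * inv b) (βPoly-suc D m) (hgDen-suc D m) ⟩
  ⟦ 6 ⟧ * ρ * inv (hgDen D m * ρ)                 ≡⟨ cong (⟦ 6 ⟧ * ρ *_) (inv-* (hgDen-≢0 (ℕP.<⇒≤ m<D)) (hgRatio-≢0 m<D)) ⟩
  ⟦ 6 ⟧ * ρ * (inv (hgDen D m) * inv ρ)           ≡⟨ identity ρ (inv (hgDen D m)) (inv ρ) ⟩
  ⟦ 6 ⟧ * inv (hgDen D m) * (ρ * inv ρ)           ≡⟨ cong (⟦ 6 ⟧ * inv (hgDen D m) *_) (*-inv (hgRatio-≢0 m<D)) ⟩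
  ⟦ 6 ⟧ * inv (hgDen D m) * 1ℚ                    ≡⟨ ℚP.*-identityʳ _ ⟩
  ⟦ 6 ⟧ * inv (hgDen D m)                         ∎
  where
  ρ = hgRatio D m
  identity : ∀ ρ a b → ⟦ 6 ⟧ * ρ * (a * b) ≡ ⟦ 6 ⟧ * a * (ρ * b)
  identity = solve-∀ ℚ-ring

poch-neg≡0 : ∀ s n → s < n → poch (- ⟦ s ⟧) n ≡ 0ℚ
poch-neg≡0 s (suc n) s<1+n with ℕP.m≤n⇒m<n∨m≡n (ℕP.≤-pred s<1+n)
... | inj₁ s<n  = trans (cong (_* (- ⟦ s ⟧ + ⟦ n ⟧)) (poch-neg≡0 s n s<n)) (ℚP.*-zeroˡ (- ⟦ s ⟧ + ⟦ n ⟧))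
... | inj₂ refl = trans (cong (poch (- ⟦ s ⟧) s *_) (ℚP.+-inverseˡ ⟦ s ⟧)) (ℚP.*-zeroʳ (poch (- ⟦ s ⟧) s))

hypTerm : ℕ → ℚ → ℚ → ℕ → ℚ
hypTerm D x y n = pairPoch x n * pairPoch y n * inv (hgDen D n)

hyp : ℕ → ℚ → ℚ → ℚ
hyp D x y = sumTo (hypTerm D x y) D

F43≡hyp : ∀ D i j → F43 D i j ≡ hyp D ⟦ i ⟧ ⟦ j ⟧
F43≡hyp D i j = sumTo-cong D (λ n _ → begin
  term D i j n
    ≡⟨ ÷'≡*inv _ (hgDen D n) ⟩
  poch (- ⟦ i ⟧) n * poch ⟦ i ℕ.+ 1 ⟧ n * poch (- ⟦ j ⟧) n * poch ⟦ j ℕ.+ 1 ⟧ n * inv (hgDen D n)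
    ≡⟨ cong₂ (λ a b → poch (- ⟦ i ⟧) n * poch a n * poch (- ⟦ j ⟧) n * poch b n * inv (hgDen D n))
             (⟦⟧-+ i 1) (⟦⟧-+ j 1) ⟩
  poch (- ⟦ i ⟧) n * poch (⟦ i ⟧ + 1ℚ) n * poch (- ⟦ j ⟧) n * poch (⟦ j ⟧ + 1ℚ) n * inv (hgDen D n)
    ≡⟨ cong (_* inv (hgDen D n)) (ℚP.*-assoc (pairPoch ⟦ i ⟧ n) _ _) ⟩
  hypTerm D ⟦ i ⟧ ⟦ j ⟧ n ∎)

hyp-sym : ∀ D x y → hyp D x y ≡ hyp D y x
hyp-sym D x y = sumTo-cong D (λ n _ → cong (_* inv (hgDen D n)) (ℚP.*-comm (pairPoch x n) (pairPoch y n)))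

F43-sym : ∀ D i j → F43 D i j ≡ F43 D j i
F43-sym D i j = trans (F43≡hyp D i j) (trans (hyp-sym D ⟦ i ⟧ ⟦ j ⟧) (sym (F43≡hyp D j i)))

module _ (D : ℕ) {s : ℕ} (x : ℚ) where
  private
    d σ : ℚ
    d = ⟦ D ⟧
    σ = ⟦ s ⟧

    T : ℚ → ℕ → ℚ
    T y = hypTerm D y σ

    diag up down : ℕ → ℚ
    diag n = odd x * θPoly d ⟦ n ⟧ * T x n
    up   n = ⟦ 6 ⟧ * pairPoch x n * pairPoch σ (suc n) * inv (hgDen D n)
    down n = βPoly d ⟦ n ⟧ * pairPoch x (n ℕ.∸ 1) * pairPoch σ n * inv (hgDen D n)

  hypTerm-shift : ∀ n → odd x * θPoly d σ * T x n ≡ diag n + odd x * up n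
  hypTerm-shift n = begin
    o * θPoly d σ * (p * q * w)                  ≡⟨ regroup o (θPoly d σ) p q w ⟩
    o * p * w * (θPoly d σ * q)                  ≡⟨ cong (o * p * w *_) (pairPoch-shift d σ n) ⟩
    o * p * w * (θPoly d ⟦ n ⟧ * q + ⟦ 6 ⟧ * q′) ≡⟨ expand o p w (θPoly d ⟦ n ⟧) q q′ ⟩
    diag n + o * up n                            ∎
    where
    o = odd x
    p = pairPoch x n
    q = pairPoch σ n
    q′ = pairPoch σ (suc n)
    w = inv (hgDen D n)
    regroup : ∀ o θ p q w → o * θ * (p * q * w) ≡ o * p * w * (θ * q)
    regroup = solve-∀ ℚ-ring
    expand : ∀ o p w θ q q′ → o * p * w * (θ * q + ⟦ 6 ⟧ * q′) ≡ o * θ * (p * q * w) + o * (⟦ 6 ⟧ * p * q′ * w)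
    expand = solve-∀ ℚ-ring

  hypTerm-contiguous : ∀ n → cPoly d x * T (x - 1ℚ) n + aPoly x * odd x * T x n + bPoly d x * T (x + 1ℚ) n
                             ≡ diag n + odd x * down n
  hypTerm-contiguous n = begin
    cPoly d x * (p₋ * q * w) + aPoly x * odd x * (p * q * w) + bPoly d x * (p₊ * q * w)
      ≡⟨ factor (cPoly d x) (aPoly x * odd x) (bPoly d x) p₋ p p₊ q w ⟩
    (cPoly d x * p₋ + aPoly x * odd x * p + bPoly d x * p₊) * (q * w)
      ≡⟨ cong (_* (q * w)) (pairPoch-contiguous d x n) ⟩
    odd x * (θPoly d ⟦ n ⟧ * p + βPoly d ⟦ n ⟧ * p′) * (q * w)
      ≡⟨ expand (odd x) (θPoly d ⟦ n ⟧) (βPoly d ⟦ n ⟧) p p′ q w ⟩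
    diag n + odd x * down n ∎
    where
    p₋ = pairPoch (x - 1ℚ) n
    p  = pairPoch x n
    p₊ = pairPoch (x + 1ℚ) n
    p′ = pairPoch x (n ℕ.∸ 1)
    q  = pairPoch σ n
    w  = inv (hgDen D n)
    factor : ∀ c a b p₋ p p₊ q w →
             c * (p₋ * q * w) + a * (p * q * w) + b * (p₊ * q * w) ≡ (c * p₋ + a * p + b * p₊) * (q * w)
    factor = solve-∀ ℚ-ring
    expand : ∀ o θ β p p′ q w → o * (θ * p + β * p′) * (q * w) ≡ o * θ * (p * q * w) + o * (β * p′ * q * w)
    expand = solve-∀ ℚ-ring

  sumTo-down≡sumTo-up : s ≤ D → sumTo down D ≡ sumTo up D
  sumTo-down≡sumTo-up s≤D = sumTo-telescope down up D down-0 up-D down-suc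
    where
    down-0 : down 0 ≡ 0ℚ
    down-0 = vanish d (pairPoch x 0) (pairPoch σ 0) (inv (hgDen D 0))
      where
      vanish : ∀ d a b c → ⟦ 6 ⟧ * ⟦ 0 ⟧ * ⟦ 0 ⟧ * (d + 1ℚ + ⟦ 0 ⟧) * (⟦ 0 ⟧ - 1ℚ - d) * a * b * c ≡ 0ℚ
      vanish = solve-∀ ℚ-ring
    up-D : up D ≡ 0ℚ
    up-D = begin
      ⟦ 6 ⟧ * pairPoch x D * (poch (- σ) (suc D) * poch (σ + 1ℚ) (suc D)) * inv (hgDen D D)
        ≡⟨ cong (λ z → ⟦ 6 ⟧ * pairPoch x D * (z * poch (σ + 1ℚ) (suc D)) * inv (hgDen D D))
                (poch-neg≡0 s (suc D) (s≤s s≤D)) ⟩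
      ⟦ 6 ⟧ * pairPoch x D * (0ℚ * poch (σ + 1ℚ) (suc D)) * inv (hgDen D D)
        ≡⟨ vanish (pairPoch x D) (poch (σ + 1ℚ) (suc D)) (inv (hgDen D D)) ⟩
      0ℚ ∎
      where
      vanish : ∀ a b c → ⟦ 6 ⟧ * a * (0ℚ * b) * c ≡ 0ℚ
      vanish = solve-∀ ℚ-ring
    down-suc : ∀ m → m < D → down (suc m) ≡ up m
    down-suc m m<D = begin
      βPoly d ⟦ suc m ⟧ * p * q * inv (hgDen D (suc m))   ≡⟨ regroup (βPoly d ⟦ suc m ⟧) p q (inv (hgDen D (suc m))) ⟩
      βPoly d ⟦ suc m ⟧ * inv (hgDen D (suc m)) * (p * q) ≡⟨ cong (_* (p * q)) (βPoly*inv-hgDen m<D) ⟩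
      ⟦ 6 ⟧ * inv (hgDen D m) * (p * q)                    ≡⟨ regroup′ (inv (hgDen D m)) p q ⟩
      up m                                                 ∎
      where
      p = pairPoch x m
      q = pairPoch σ (suc m)
      regroup : ∀ β p q w → β * p * q * w ≡ β * w * (p * q)
      regroup = solve-∀ ℚ-ring
      regroup′ : ∀ w p q → ⟦ 6 ⟧ * w * (p * q) ≡ ⟦ 6 ⟧ * p * q * w
      regroup′ = solve-∀ ℚ-ring

  hyp-recurrence : s ≤ D →
    odd x * θPoly d σ * hyp D x σ
    ≡ cPoly d x * hyp D (x - 1ℚ) σ + aPoly x * odd x * hyp D x σ + bPoly d x * hyp D (x + 1ℚ) σ
  hyp-recurrence s≤D = begin
    odd x * θPoly d σ * hyp D x σ
      ≡⟨ sumTo-*ˡ (odd x * θPoly d σ) (T x) D ⟨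
    sumTo (λ n → odd x * θPoly d σ * T x n) D
      ≡⟨ sumTo-cong D (λ n _ → hypTerm-shift n) ⟩
    sumTo (λ n → diag n + odd x * up n) D
      ≡⟨ sumTo-+-*ˡ diag (odd x) up D ⟩
    sumTo diag D + odd x * sumTo up D
      ≡⟨ cong (λ z → sumTo diag D + odd x * z) (sumTo-down≡sumTo-up s≤D) ⟨
    sumTo diag D + odd x * sumTo down D
      ≡⟨ sumTo-+-*ˡ diag (odd x) down D ⟨
    sumTo (λ n → diag n + odd x * down n) D
      ≡⟨ sumTo-cong D (λ n _ → hypTerm-contiguous n) ⟨
    sumTo (λ n → cPoly d x * T (x - 1ℚ) n + aPoly x * odd x * T x n + bPoly d x * T (x + 1ℚ) n) D
      ≡⟨ sumTo-linear₃ (cPoly d x) (aPoly x * odd x) (bPoly d x) (T (x - 1ℚ)) (T x) (T (x + 1ℚ)) D ⟩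
    cPoly d x * hyp D (x - 1ℚ) σ + aPoly x * odd x * hyp D x σ + bPoly d x * hyp D (x + 1ℚ) σ ∎

weight : ℕ → ℚ
weight r = ⟦ 2 ℕ.* r ℕ.+ 1 ⟧

weight≡odd : ∀ r → weight r ≡ odd ⟦ r ⟧
weight≡odd r = begin
  ⟦ r ℕ.+ (r ℕ.+ 0) ℕ.+ 1 ⟧         ≡⟨ ⟦⟧-+ (r ℕ.+ (r ℕ.+ 0)) 1 ⟩
  ⟦ r ℕ.+ (r ℕ.+ 0) ⟧ + 1ℚ          ≡⟨ cong (_+ 1ℚ) (trans (⟦⟧-+ r (r ℕ.+ 0)) (cong (⟦ r ⟧ +_) (⟦⟧-+ r 0))) ⟩
  ⟦ r ⟧ + (⟦ r ⟧ + ⟦ 0 ⟧) + 1ℚ      ≡⟨ identity ⟦ r ⟧ ⟩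
  odd ⟦ r ⟧                         ∎
  where
  identity : ∀ a → a + (a + ⟦ 0 ⟧) + 1ℚ ≡ ⟦ 2 ⟧ * a + 1ℚ
  identity = solve-∀ ℚ-ring

weight≢0 : ∀ r → weight r ≢ 0ℚ
weight≢0 r eq = ⟦suc⟧≢0 (2 ℕ.* r) (trans (cong ⟦_⟧ (ℕP.+-comm 1 (2 ℕ.* r))) eq)

den≢0 : ∀ {D} → 1 ≤ D → den D ≢ 0ℚ
den≢0 {suc D} _ = *-≢0 (⟦suc⟧≢0 D) (⟦suc⟧≢0 (D ℕ.+ 2))

fullDen : ℕ → ℕ → ℚ
fullDen D r = den D * weight r

fullDen≢0 : ∀ {D} r → 1 ≤ D → fullDen D r ≢ 0ℚ
fullDen≢0 r 1≤D = *-≢0 (den≢0 1≤D) (weight≢0 r)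

cc*fullDen : ∀ {D r} → 1 ≤ D → r ≤ D → cc D r * fullDen D r ≡ cPoly ⟦ D ⟧ ⟦ r ⟧
cc*fullDen {D} {r} 1≤D r≤D = begin
  cc D r * fullDen D r
    ≡⟨ ÷'-*-cancel _ (fullDen≢0 r 1≤D) ⟩
  ⟦ 3 ⟧ * ⟦ D ℕ.∸ r ℕ.+ 1 ⟧ * ⟦ r ⟧ * ⟦ D ℕ.+ r ℕ.+ 1 ⟧
    ≡⟨ cong₂ (λ a b → ⟦ 3 ⟧ * a * ⟦ r ⟧ * b)
             (trans (⟦⟧-+ (D ℕ.∸ r) 1) (cong (_+ 1ℚ) (⟦⟧-∸ r≤D)))
             (trans (⟦⟧-+ (D ℕ.+ r) 1) (cong (_+ 1ℚ) (⟦⟧-+ D r))) ⟩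
  cPoly ⟦ D ⟧ ⟦ r ⟧ ∎

aa*fullDen : ∀ {D} r → 1 ≤ D → aa D r * fullDen D r ≡ aPoly ⟦ r ⟧ * odd ⟦ r ⟧
aa*fullDen {D} r 1≤D = begin
  aa D r * (den D * weight r)                 ≡⟨ ℚP.*-assoc (aa D r) (den D) (weight r) ⟨
  aa D r * den D * weight r                   ≡⟨ cong₂ _*_ (÷'-*-cancel _ (den≢0 1≤D)) (weight≡odd r) ⟩
  ⟦ 3 ⟧ * ⟦ r ⟧ * ⟦ r ℕ.+ 1 ⟧ * odd ⟦ r ⟧     ≡⟨ cong (λ a → ⟦ 3 ⟧ * ⟦ r ⟧ * a * odd ⟦ r ⟧) (⟦⟧-+ r 1) ⟩
  aPoly ⟦ r ⟧ * odd ⟦ r ⟧                     ∎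

bb*fullDen : ∀ {D r} → 1 ≤ D → r ≤ D → bb D r * fullDen D r ≡ bPoly ⟦ D ⟧ ⟦ r ⟧
bb*fullDen {D} {r} 1≤D r≤D = begin
  bb D r * fullDen D r
    ≡⟨ ÷'-*-cancel _ (fullDen≢0 r 1≤D) ⟩
  ⟦ 3 ⟧ * ⟦ D ℕ.∸ r ⟧ * ⟦ r ℕ.+ 1 ⟧ * ⟦ D ℕ.+ r ℕ.+ 2 ⟧
    ≡⟨ cong₃ (λ a b c → ⟦ 3 ⟧ * a * b * c) (⟦⟧-∸ r≤D) (⟦⟧-+ r 1)
             (trans (⟦⟧-+ (D ℕ.+ r) 2) (cong (_+ ⟦ 2 ⟧) (⟦⟧-+ D r))) ⟩
  bPoly ⟦ D ⟧ ⟦ r ⟧ ∎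

θ*fullDen : ∀ {D} r s → 1 ≤ D → θ D s * fullDen D r ≡ odd ⟦ r ⟧ * θPoly ⟦ D ⟧ ⟦ s ⟧
θ*fullDen {D} r s 1≤D = begin
  θ D s * (den D * weight r)
    ≡⟨ expand (aa D s) (den D) (weight r) ⟩
  (⟦ 3 ⟧ * den D - ⟦ 2 ⟧ * (aa D s * den D)) * weight r
    ≡⟨ cong₃ (λ a b c → (⟦ 3 ⟧ * a - ⟦ 2 ⟧ * b) * c)
             (cong (⟦ D ⟧ *_) (⟦⟧-+ D 2)) (÷'-*-cancel _ (den≢0 1≤D)) (weight≡odd r) ⟩
  (⟦ 3 ⟧ * (⟦ D ⟧ * (⟦ D ⟧ + ⟦ 2 ⟧)) - ⟦ 2 ⟧ * (⟦ 3 ⟧ * ⟦ s ⟧ * ⟦ s ℕ.+ 1 ⟧)) * odd ⟦ r ⟧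
    ≡⟨ cong (λ a → (⟦ 3 ⟧ * (⟦ D ⟧ * (⟦ D ⟧ + ⟦ 2 ⟧)) - ⟦ 2 ⟧ * (⟦ 3 ⟧ * ⟦ s ⟧ * a)) * odd ⟦ r ⟧) (⟦⟧-+ s 1) ⟩
  (⟦ 3 ⟧ * (⟦ D ⟧ * (⟦ D ⟧ + ⟦ 2 ⟧)) - ⟦ 2 ⟧ * (⟦ 3 ⟧ * ⟦ s ⟧ * (⟦ s ⟧ + 1ℚ))) * odd ⟦ r ⟧
    ≡⟨ identity (⟦ D ⟧ * (⟦ D ⟧ + ⟦ 2 ⟧)) ⟦ s ⟧ (odd ⟦ r ⟧) ⟩
  odd ⟦ r ⟧ * θPoly ⟦ D ⟧ ⟦ s ⟧ ∎
  where
  expand : ∀ a n w → (⟦ 3 ⟧ - ⟦ 2 ⟧ * a) * (n * w) ≡ (⟦ 3 ⟧ * n - ⟦ 2 ⟧ * (a * n)) * w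
  expand = solve-∀ ℚ-ring
  identity : ∀ e σ o → (⟦ 3 ⟧ * e - ⟦ 2 ⟧ * (⟦ 3 ⟧ * σ * (σ + 1ℚ))) * o ≡ o * (⟦ 3 ⟧ * e - ⟦ 6 ⟧ * σ * (σ + 1ℚ))
  identity = solve-∀ ℚ-ring

cc[0]≡0 : ∀ D → cc D 0 ≡ 0ℚ
cc[0]≡0 D = trans (÷'≡*inv _ (fullDen D 0)) (vanish ⟦ D ℕ.∸ 0 ℕ.+ 1 ⟧ ⟦ D ℕ.+ 0 ℕ.+ 1 ⟧ (inv (fullDen D 0)))
  where
  vanish : ∀ a b w → ⟦ 3 ⟧ * a * ⟦ 0 ⟧ * b * w ≡ 0ℚ
  vanish = solve-∀ ℚ-ring

bb[D]≡0 : ∀ D → bb D D ≡ 0ℚ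
bb[D]≡0 D = begin
  bb D D                                              ≡⟨ ÷'≡*inv _ (fullDen D D) ⟩
  ⟦ 3 ⟧ * ⟦ D ℕ.∸ D ⟧ * a * b * inv (fullDen D D)     ≡⟨ cong (λ n → ⟦ 3 ⟧ * ⟦ n ⟧ * a * b * inv (fullDen D D)) (ℕP.n∸n≡0 D) ⟩
  ⟦ 3 ⟧ * ⟦ 0 ⟧ * a * b * inv (fullDen D D)           ≡⟨ vanish a b (inv (fullDen D D)) ⟩
  0ℚ                                                  ∎
  where
  a = ⟦ D ℕ.+ 1 ⟧
  b = ⟦ D ℕ.+ D ℕ.+ 2 ⟧
  vanish : ∀ a b w → ⟦ 3 ⟧ * ⟦ 0 ⟧ * a * b * w ≡ 0ℚ
  vanish = solve-∀ ℚ-ring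

weight*bb≡cc*weight : ∀ {D k} → 1 ≤ D → suc k ≤ D → weight k * bb D k ≡ cc D (suc k) * weight (suc k)
weight*bb≡cc*weight {D} {k} 1≤D k<D = *-cancelʳ (den D) (den≢0 1≤D) (begin
  weight k * bb D k * den D                  ≡⟨ regroup (weight k) (bb D k) (den D) ⟩
  bb D k * fullDen D k                       ≡⟨ bb*fullDen 1≤D (ℕP.<⇒≤ k<D) ⟩
  bPoly ⟦ D ⟧ ⟦ k ⟧                          ≡⟨ identity ⟦ D ⟧ ⟦ k ⟧ ⟩
  cPoly ⟦ D ⟧ (⟦ k ⟧ + 1ℚ)                   ≡⟨ cong (cPoly ⟦ D ⟧) (⟦⟧-suc k) ⟨
  cPoly ⟦ D ⟧ ⟦ suc k ⟧                      ≡⟨ cc*fullDen 1≤D k<D ⟨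
  cc D (suc k) * fullDen D (suc k)           ≡⟨ regroup′ (cc D (suc k)) (den D) (weight (suc k)) ⟩
  cc D (suc k) * weight (suc k) * den D      ∎)
  where
  regroup : ∀ w b n → w * b * n ≡ b * (n * w)
  regroup = solve-∀ ℚ-ring
  regroup′ : ∀ c n w → c * (n * w) ≡ c * w * n
  regroup′ = solve-∀ ℚ-ring
  identity : ∀ d x → ⟦ 3 ⟧ * (d - x) * (x + 1ℚ) * (d + x + ⟦ 2 ⟧)
                     ≡ ⟦ 3 ⟧ * (d - (x + 1ℚ) + 1ℚ) * (x + 1ℚ) * (d + (x + 1ℚ) + 1ℚ)
  identity = solve-∀ ℚ-ring

F43-recurrence : ∀ {D r s} → 1 ≤ D → r ≤ D → s ≤ D →
  θ D s * F43 D r s ≡ cc D r * F43 D (r ℕ.∸ 1) s + aa D r * F43 D r s + bb D r * F43 D (suc r) s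
F43-recurrence {D} {r} {s} 1≤D r≤D s≤D = *-cancelʳ (fullDen D r) (fullDen≢0 r 1≤D) (begin
  θ D s * F r * K
    ≡⟨ swap (θ D s) (F r) K ⟩
  θ D s * K * F r
    ≡⟨ cong₂ _*_ (θ*fullDen r s 1≤D) (F43≡hyp D r s) ⟩
  odd ρ * θPoly d σ * H ρ
    ≡⟨ hyp-recurrence D ρ s≤D ⟩
  cPoly d ρ * H (ρ - 1ℚ) + aPoly ρ * odd ρ * H ρ + bPoly d ρ * H (ρ + 1ℚ)
    ≡⟨ cong₃ (λ a b c → a + aPoly ρ * odd ρ * b + bPoly d ρ * c)
             (cPoly-hyp-pred r) (sym (F43≡hyp D r s))
             (trans (cong H (sym (⟦⟧-suc r))) (sym (F43≡hyp D (suc r) s))) ⟩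
  cPoly d ρ * F (r ℕ.∸ 1) + aPoly ρ * odd ρ * F r + bPoly d ρ * F (suc r)
    ≡⟨ cong₃ (λ a b c → a * F (r ℕ.∸ 1) + b * F r + c * F (suc r))
             (cc*fullDen 1≤D r≤D) (aa*fullDen r 1≤D) (bb*fullDen 1≤D r≤D) ⟨
  cc D r * K * F (r ℕ.∸ 1) + aa D r * K * F r + bb D r * K * F (suc r)
    ≡⟨ factor (cc D r) (aa D r) (bb D r) K (F (r ℕ.∸ 1)) (F r) (F (suc r)) ⟩
  (cc D r * F (r ℕ.∸ 1) + aa D r * F r + bb D r * F (suc r)) * K ∎)
  where
  d ρ σ K : ℚ
  d = ⟦ D ⟧
  ρ = ⟦ r ⟧
  σ = ⟦ s ⟧
  K = fullDen D r

  F : ℕ → ℚ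
  F i = F43 D i s

  H : ℚ → ℚ
  H x = hyp D x σ

  -- At r = 0 the factor c(0) = 0 hides the mismatch between 0 ∸ 1 = 0 and -1.
  cPoly-hyp-pred : ∀ r → cPoly d ⟦ r ⟧ * H (⟦ r ⟧ - 1ℚ) ≡ cPoly d ⟦ r ⟧ * F (r ℕ.∸ 1)
  cPoly-hyp-pred zero    = trans (vanish d (H (⟦ 0 ⟧ - 1ℚ))) (sym (vanish d (F 0)))
    where
    vanish : ∀ d a → ⟦ 3 ⟧ * (d - ⟦ 0 ⟧ + 1ℚ) * ⟦ 0 ⟧ * (d + ⟦ 0 ⟧ + 1ℚ) * a ≡ 0ℚ
    vanish = solve-∀ ℚ-ring
  cPoly-hyp-pred (suc r) = cong (cPoly d ⟦ suc r ⟧ *_) (begin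
    H (⟦ suc r ⟧ - 1ℚ)  ≡⟨ cong (λ x → H (x - 1ℚ)) (⟦⟧-suc r) ⟩
    H (⟦ r ⟧ + 1ℚ - 1ℚ) ≡⟨ cong H (cancel ⟦ r ⟧) ⟩
    H ⟦ r ⟧             ≡⟨ F43≡hyp D r s ⟨
    F r                 ∎)
    where
    cancel : ∀ x → x + 1ℚ - 1ℚ ≡ x
    cancel = solve-∀ ℚ-ring

  swap : ∀ θ f k → θ * f * k ≡ θ * k * f
  swap = solve-∀ ℚ-ring
  factor : ∀ c a b k x y z → c * k * x + a * k * y + b * k * z ≡ (c * x + a * y + b * z) * k
  factor = solve-∀ ℚ-ring

-- Intertwining A and A*

∑-entryA-row : ∀ D {r} → r ≤ D → (f : ℕ → ℚ) →
  ∑ {suc D} (λ k → entryA D r (toℕ k) * f (toℕ k)) ≡ cc D r * f (r ℕ.∸ 1) + aa D r * f r + bb D r * f (suc r)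
∑-entryA-row D {r} r≤D f = begin
  ∑ {suc D} (λ k → entryA D r (toℕ k) * f (toℕ k))
    ≡⟨ ∑-cong {suc D} (λ k → distrib (aa D r) (bb D r) (cc D r) (δ r (toℕ k)) (δ (suc r) (toℕ k)) (δ r (suc (toℕ k))) (f (toℕ k))) ⟩
  ∑ {suc D} (λ k → aa D r * on r k + bb D r * on (suc r) k + cc D r * below k)
    ≡⟨ ∑-linear₃ (aa D r) (bb D r) (cc D r) (on r) (on (suc r)) below ⟩
  aa D r * ∑ (on r) + bb D r * ∑ (on (suc r)) + cc D r * ∑ below
    ≡⟨ cong₃ (λ p q s → aa D r * p + q + s) (∑-δ-< {suc D} f (s≤s r≤D)) (above-sum r≤D) (below-sum r≤D) ⟩
  aa D r * f r + bb D r * f (suc r) + cc D r * f (r ℕ.∸ 1)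
    ≡⟨ rotate (aa D r * f r) (bb D r * f (suc r)) (cc D r * f (r ℕ.∸ 1)) ⟩
  cc D r * f (r ℕ.∸ 1) + aa D r * f r + bb D r * f (suc r) ∎
  where
  on : ℕ → Fin (suc D) → ℚ
  on t k = δ t (toℕ k) * f (toℕ k)

  below : Fin (suc D) → ℚ
  below k = δ r (suc (toℕ k)) * f (toℕ k)

  above-sum : ∀ {r} → r ≤ D → bb D r * ∑ (on (suc r)) ≡ bb D r * f (suc r)
  above-sum {r} r≤D with ℕP.m≤n⇒m<n∨m≡n r≤D
  ... | inj₁ r<D  = cong (bb D r *_) (∑-δ-< {suc D} f (s≤s r<D))
  ... | inj₂ refl = begin
    bb D D * ∑ {suc D} (on (suc D)) ≡⟨ cong (bb D D *_) (∑-δ-≥ {suc D} f {suc D} ℕP.≤-refl) ⟩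
    bb D D * 0ℚ             ≡⟨ ℚP.*-zeroʳ (bb D D) ⟩
    0ℚ                      ≡⟨ ℚP.*-zeroˡ (f (suc D)) ⟨
    0ℚ * f (suc D)          ≡⟨ cong (_* f (suc D)) (bb[D]≡0 D) ⟨
    bb D D * f (suc D)      ∎

  below-sum : ∀ {r} → r ≤ D → cc D r * ∑ {suc D} (λ k → δ r (suc (toℕ k)) * f (toℕ k)) ≡ cc D r * f (r ℕ.∸ 1)
  below-sum {zero}  _   = begin
    cc D 0 * ∑ {suc D} (λ k → δ 0 (suc (toℕ k)) * f (toℕ k)) ≡⟨ cong (cc D 0 *_) (∑-zero {suc D} _ (λ k → ℚP.*-zeroˡ (f (toℕ k)))) ⟩
    cc D 0 * 0ℚ                                       ≡⟨ ℚP.*-zeroʳ (cc D 0) ⟩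
    0ℚ                                                ≡⟨ ℚP.*-zeroˡ (f 0) ⟨
    0ℚ * f 0                                          ≡⟨ cong (_* f 0) (cc[0]≡0 D) ⟨
    cc D 0 * f 0                                      ∎
  below-sum {suc r} r<D = cong (cc D (suc r) *_)
    (trans (∑-cong {suc D} (λ k → cong (_* f (toℕ k)) (δ-suc r (toℕ k)))) (∑-δ-< {suc D} f (s≤s (ℕP.<⇒≤ r<D))))

  distrib : ∀ a b c δ₁ δ₂ δ₃ x → (a * δ₁ + b * δ₂ + c * δ₃) * x ≡ a * (δ₁ * x) + b * (δ₂ * x) + c * (δ₃ * x)
  distrib = solve-∀ ℚ-ring
  rotate : ∀ p q s → p + q + s ≡ s + p + q
  rotate = solve-∀ ℚ-ring

∑-entryA-row-F43 : ∀ {D r s} → 1 ≤ D → r ≤ D → s ≤ D →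
  ∑ {suc D} (λ k → entryA D r (toℕ k) * F43 D (toℕ k) s) ≡ θ D s * F43 D r s
∑-entryA-row-F43 {D} {r} {s} 1≤D r≤D s≤D =
  trans (∑-entryA-row D r≤D (λ k → F43 D k s)) (sym (F43-recurrence 1≤D r≤D s≤D))

weight*entryA-sym : ∀ {D k s} → 1 ≤ D → k ≤ D → s ≤ D → weight k * entryA D k s ≡ entryA D s k * weight s
weight*entryA-sym {D} {k} {s} 1≤D k≤D s≤D = begin
  weight k * entryA D k s
    ≡⟨ distrib (weight k) (aa D k) (bb D k) (cc D k) (δ k s) (δ (suc k) s) (δ k (suc s)) ⟩
  weight k * aa D k * δ k s + weight k * bb D k * δ (suc k) s + weight k * cc D k * δ k (suc s)
    ≡⟨ cong₃ (λ p q r → p + q + r) (*δ-cong k s diagonal) (*δ-cong (suc k) s (above s≤D)) (*δ-cong k (suc s) (below k≤D)) ⟩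
  aa D s * weight s * δ k s + cc D s * weight s * δ (suc k) s + bb D s * weight s * δ k (suc s)
    ≡⟨ cong₃ (λ p q r → aa D s * weight s * p + cc D s * weight s * q + bb D s * weight s * r)
             (δ-sym k s) (δ-sym (suc k) s) (δ-sym k (suc s)) ⟩
  aa D s * weight s * δ s k + cc D s * weight s * δ s (suc k) + bb D s * weight s * δ (suc s) k
    ≡⟨ collect (weight s) (aa D s) (bb D s) (cc D s) (δ s k) (δ (suc s) k) (δ s (suc k)) ⟩
  entryA D s k * weight s ∎
  where
  diagonal : ∀ {k s} → k ≡ s → weight k * aa D k ≡ aa D s * weight s
  diagonal {k} refl = ℚP.*-comm (weight k) (aa D k)
  above : ∀ {k s} → s ≤ D → suc k ≡ s → weight k * bb D k ≡ cc D s * weight s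
  above s≤D refl = weight*bb≡cc*weight 1≤D s≤D
  below : ∀ {k s} → k ≤ D → k ≡ suc s → weight k * cc D k ≡ bb D s * weight s
  below {k} {s} k≤D refl = begin
    weight k * cc D k  ≡⟨ ℚP.*-comm (weight k) (cc D k) ⟩
    cc D k * weight k  ≡⟨ weight*bb≡cc*weight 1≤D k≤D ⟨
    weight s * bb D s  ≡⟨ ℚP.*-comm (weight s) (bb D s) ⟩
    bb D s * weight s  ∎
  distrib : ∀ w a b c δ₁ δ₂ δ₃ → w * (a * δ₁ + b * δ₂ + c * δ₃) ≡ w * a * δ₁ + w * b * δ₂ + w * c * δ₃
  distrib = solve-∀ ℚ-ring
  collect : ∀ w a b c δ₁ δ₂ δ₃ → a * w * δ₁ + c * w * δ₃ + b * w * δ₂ ≡ (a * δ₁ + b * δ₂ + c * δ₃) * w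
  collect = solve-∀ ℚ-ring

P⊗A≋A*⊗P : ∀ {D} → 1 ≤ D → (P D ⊗ A D) ≋ (A* D ⊗ P D)
P⊗A≋A*⊗P {D} 1≤D r s = begin
  ∑ {suc D} (λ k → weight (toℕ k) * F43 D r′ (toℕ k) * entryA D (toℕ k) s′)
    ≡⟨ ∑-cong {suc D} (λ k → transpose k) ⟩
  ∑ {suc D} (λ k → entryA D s′ (toℕ k) * F43 D (toℕ k) r′ * weight s′)
    ≡⟨ ∑-*ʳ {suc D} (weight s′) (λ k → entryA D s′ (toℕ k) * F43 D (toℕ k) r′) ⟩
  ∑ {suc D} (λ k → entryA D s′ (toℕ k) * F43 D (toℕ k) r′) * weight s′
    ≡⟨ cong (_* weight s′) (∑-entryA-row-F43 1≤D s≤D r≤D) ⟩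
  θ D r′ * F43 D s′ r′ * weight s′
    ≡⟨ regroup (θ D r′) (weight s′) (F43-sym D s′ r′) ⟩
  θ D r′ * P D r s
    ≡⟨ cong (θ D r′ *_) (∑-δ (λ k → P D k s) r) ⟨
  θ D r′ * ∑ {suc D} (λ k → δ r′ (toℕ k) * P D k s)
    ≡⟨ ∑-*ˡ {suc D} (θ D r′) (λ k → δ r′ (toℕ k) * P D k s) ⟨
  ∑ {suc D} (λ k → θ D r′ * (δ r′ (toℕ k) * P D k s))
    ≡⟨ ∑-cong {suc D} (λ k → sym (ℚP.*-assoc (θ D r′) (δ r′ (toℕ k)) (P D k s))) ⟩
  (A* D ⊗ P D) r s ∎
  where
  r′ s′ : ℕ
  r′ = toℕ r
  s′ = toℕ s
  r≤D : r′ ≤ D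
  r≤D = FinP.toℕ≤pred[n] r
  s≤D : s′ ≤ D
  s≤D = FinP.toℕ≤pred[n] s
  transpose : ∀ k → weight (toℕ k) * F43 D r′ (toℕ k) * entryA D (toℕ k) s′
                    ≡ entryA D s′ (toℕ k) * F43 D (toℕ k) r′ * weight s′
  transpose k = begin
    weight k′ * F43 D r′ k′ * entryA D k′ s′   ≡⟨ cong (λ f → weight k′ * f * entryA D k′ s′) (F43-sym D r′ k′) ⟩
    weight k′ * F43 D k′ r′ * entryA D k′ s′   ≡⟨ swap (weight k′) (F43 D k′ r′) (entryA D k′ s′) ⟩
    F43 D k′ r′ * (weight k′ * entryA D k′ s′) ≡⟨ cong (F43 D k′ r′ *_) (weight*entryA-sym 1≤D (FinP.toℕ≤pred[n] k) s≤D) ⟩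
    F43 D k′ r′ * (entryA D s′ k′ * weight s′) ≡⟨ swap′ (F43 D k′ r′) (entryA D s′ k′) (weight s′) ⟩
    entryA D s′ k′ * F43 D k′ r′ * weight s′   ∎
    where
    k′ = toℕ k
    swap : ∀ w f a → w * f * a ≡ f * (w * a)
    swap = solve-∀ ℚ-ring
    swap′ : ∀ f a w → f * (a * w) ≡ a * f * w
    swap′ = solve-∀ ℚ-ring
  regroup : ∀ {f f′} θ w → f ≡ f′ → θ * f * w ≡ θ * (w * f′)
  regroup {f} {f′} θ w refl = trans (ℚP.*-assoc θ f w) (cong (θ *_) (ℚP.*-comm f w))

P⊗A*≋A⊗P : ∀ {D} → 1 ≤ D → (P D ⊗ A* D) ≋ (A D ⊗ P D)
P⊗A*≋A⊗P {D} 1≤D r s = begin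
  ∑ {suc D} (λ k → P D r k * (θ D (toℕ k) * δ (toℕ k) s′))
    ≡⟨ ∑-cong {suc D} (λ k → trans (cong (λ d → P D r k * (θ D (toℕ k) * d)) (δ-sym (toℕ k) s′))
                           (swap (P D r k) (θ D (toℕ k)) (δ s′ (toℕ k)))) ⟩
  ∑ {suc D} (λ k → δ s′ (toℕ k) * (P D r k * θ D (toℕ k)))
    ≡⟨ ∑-δ (λ k → P D r k * θ D (toℕ k)) s ⟩
  weight s′ * F43 D r′ s′ * θ D s′
    ≡⟨ swap′ (weight s′) (F43 D r′ s′) (θ D s′) ⟩
  weight s′ * (θ D s′ * F43 D r′ s′)
    ≡⟨ cong (weight s′ *_) (∑-entryA-row-F43 1≤D r≤D s≤D) ⟨
  weight s′ * ∑ {suc D} (λ k → entryA D r′ (toℕ k) * F43 D (toℕ k) s′)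
    ≡⟨ ∑-*ˡ {suc D} (weight s′) (λ k → entryA D r′ (toℕ k) * F43 D (toℕ k) s′) ⟨
  ∑ {suc D} (λ k → weight s′ * (entryA D r′ (toℕ k) * F43 D (toℕ k) s′))
    ≡⟨ ∑-cong {suc D} (λ k → swap″ (weight s′) (entryA D r′ (toℕ k)) (F43 D (toℕ k) s′)) ⟩
  (A D ⊗ P D) r s ∎
  where
  r′ s′ : ℕ
  r′ = toℕ r
  s′ = toℕ s
  r≤D : r′ ≤ D
  r≤D = FinP.toℕ≤pred[n] r
  s≤D : s′ ≤ D
  s≤D = FinP.toℕ≤pred[n] s
  swap : ∀ p θ d → p * (θ * d) ≡ d * (p * θ)
  swap = solve-∀ ℚ-ring
  swap′ : ∀ w f θ → w * f * θ ≡ w * (θ * f)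
  swap′ = solve-∀ ℚ-ring
  swap″ : ∀ w a f → w * (a * f) ≡ a * (w * f)
  swap″ = solve-∀ ℚ-ring

lemma4p3 : (D : ℕ) → 1 ≤ D → (i : Fin (suc D)) →
    ((P D ⊗ B D i) ≋ (B* D i ⊗ P D)) × ((P D ⊗ B* D i) ≋ (B D i ⊗ P D))
lemma4p3 D 1≤D i = evalM-intertwine (P D) (A D) (A* D) (P⊗A≋A*⊗P 1≤D) (v D (toℕ i))
                 , evalM-intertwine (P D) (A* D) (A D) (P⊗A*≋A⊗P 1≤D) (v D (toℕ i))
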